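{- Let $p$ be a prime and let $k$, $c$, $d$ be integers with $1 \leq k \leq c \leq d < c+d \leq p$. For every integer $\ell \in [1, c+d+1-k]$ define \[C(\ell)=\sum_{j=1}^{c+1-k} \binom{k+j-2}{k-1}\binom{c+d-k}{d+j-1}\binom{p-c-d+2k-2}{k+j-1-\ell}\] and \[D(\ell)=\sum_{j=1}^{d+1-k}\binom{d-j}{k-1}\binom{c+d-k}{j-1}\binom{p-c-d+2k-2}{p+k+j-d-1-\ell},\] and let $f(\ell)=C(\ell)+(-1)^k D(\ell)$. Then $f(1)\not\equiv 0 \pmod p$, and $f(\ell)\equiv (-1)^{\ell-1} f(1) \pmod p$ for every integer $\ell\in[1,c+d+1-k]$.
   Context: Binomial coefficients follow the convention: for an integer $n$ and an integer $m\ge 0$, $\binom{n}{m}=n(n-1)\cdots(n-m+1)/m!$, and $\binom{n}{m}=0$ for integers $m<0$. -}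

module Defs where

open import Data.Nat using (ℕ; zero; suc; _+_; _∸_; _*_)
open import Data.Nat.Combinatorics using (_C_)
open import Data.Integer as ℤ using (ℤ; +_; -[1+_])
open import Data.Integer.Divisibility as ℤD using ()

binomℤ : ℕ → ℤ → ℤ
binomℤ n (+ m)    = + (n C m)
binomℤ n -[1+ _ ] = + 0

sumFrom1 : ℕ → (ℕ → ℤ) → ℤ
sumFrom1 zero    f = + 0
sumFrom1 (suc N) f = sumFrom1 N f ℤ.+ f (suc N)

sgn : ℕ → ℤ
sgn zero    = + 1
sgn (suc n) = ℤ.- sgn n

_≡[mod_]_ : ℤ → ℕ → ℤ → Set
a ≡[mod p ] b = (+ p) ℤD.∣ (a ℤ.- b)

-- Using natural-number subtraction ∸ below only where the result is
-- guaranteed nonnegative under the hypotheses 1 ≤ k ≤ c ≤ d, c + d ≤ p,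
-- 1 ≤ j ≤ (c or d) + 1 - k.
module _ (p k c d : ℕ) where
  Cf : ℕ → ℤ
  Cf ℓ = sumFrom1 (c + 1 ∸ k) λ j →
    binomℤ (k + j ∸ 2) (+ (k ∸ 1)) ℤ.*
    binomℤ (c + d ∸ k) (+ (d + j ∸ 1)) ℤ.*
    binomℤ (p + 2 * k ∸ (c + d) ∸ 2) ((+ (k + j)) ℤ.- + 1 ℤ.- + ℓ)

  Df : ℕ → ℤ
  Df ℓ = sumFrom1 (d + 1 ∸ k) λ j →
    binomℤ (d ∸ j) (+ (k ∸ 1)) ℤ.*
    binomℤ (c + d ∸ k) (+ (j ∸ 1)) ℤ.*
    binomℤ (p + 2 * k ∸ (c + d) ∸ 2) ((+ (p + k + j)) ℤ.- + d ℤ.- + 1 ℤ.- + ℓ)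

  ff : ℕ → ℤ
  ff ℓ = Cf ℓ ℤ.+ sgn k ℤ.* Df ℓ

-- Write k = 1 + K, m = c + d - k, r = m - K and N = p + 2k - c - d - 2 = p - 1 - r, the upper index of the
-- third binomial in every summand.  As N ≡ -(r + 1) modulo p, in the range that occurs
-- C(N, t - r) ≡ (-1)^(t+r) C(t, r) and C(N, p - y) ≡ -(-1)^y C(r - y, r), where C(x, r) with integer x is
-- the polynomial x(x - 1)⋯(x - r + 1)/r!.  After these substitutions, and reversing both sums, the
-- summands of C(ℓ) and of (-1)^k D(ℓ) are exactly the terms with v ≤ c - k and with v ≥ c of
--   (-1)^(ℓ+c) Σ_{v=0}^{m} (-1)^v C(m, v) g(c - v),   g(y) = C(y - 1, K) C(y + r - ℓ, r),
-- and the remaining terms vanish because C(y - 1, K) = 0 for 1 ≤ y ≤ K.  The sum is the m-th backward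
-- difference at c of g, a polynomial of degree m with leading coefficient 1/(K! r!), so it equals
-- C(m, K).  Hence f(ℓ) ≡ (-1)^(ℓ+c) C(m, K) (mod p), and p does not divide C(m, K) because m < p.

module Submission where

open import Data.Empty using (⊥-elim)
open import Data.Integer as ℤ using (ℤ; +_; -[1+_]; _+_; _-_; _*_; -_)
import Data.Integer.Divisibility.Signed as ℤ∣
import Data.Integer.Properties as ℤP
open import Data.Integer.Tactic.RingSolver using (solve-∀)
open import Data.Nat as ℕ using (ℕ; zero; suc; z≤n; s≤s)
open import Data.Nat.Combinatorics using (_C_; nCk+nC[k+1]≡[n+1]C[k+1]; nCk≡nC[n∸k]; nCn≡1; nC1≡n; k>n⇒nCk≡0)
import Data.Nat.Divisibility as ℕ∣
open import Data.Nat.Primality using (Prime; euclidsLemma; prime⇒nonTrivial)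
import Data.Nat.Properties as ℕP
import Data.Nat.Tactic.RingSolver as ℕSolver
open import Data.Product using (_×_; _,_)
open import Data.Sum using (inj₁; inj₂)
open import Relation.Binary.Bundles using (Setoid)
import Relation.Binary.Reasoning.Setoid
open import Relation.Binary.PropositionalEquality
open import Relation.Nullary using (¬_; yes; no)

open import Defs

sgn-+ : ∀ m n → sgn (m ℕ.+ n) ≡ sgn m * sgn n
sgn-+ zero    n = sym (ℤP.*-identityˡ (sgn n))
sgn-+ (suc m) n = trans (cong -_ (sgn-+ m n)) (ℤP.neg-distribˡ-* (sgn m) (sgn n))

sgn*sgn≡1 : ∀ n → sgn n * sgn n ≡ + 1
sgn*sgn≡1 zero    = refl
sgn*sgn≡1 (suc n) = trans (-x*-x≡x*x (sgn n)) (sgn*sgn≡1 n)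
  where
  -x*-x≡x*x : ∀ x → - x * - x ≡ x * x
  -x*-x≡x*x = solve-∀

sgn-+-double : ∀ m n → sgn (m ℕ.+ (n ℕ.+ n)) ≡ sgn m
sgn-+-double m n = begin
  sgn (m ℕ.+ (n ℕ.+ n))   ≡⟨ sgn-+ m (n ℕ.+ n) ⟩
  sgn m * sgn (n ℕ.+ n)   ≡⟨ cong (sgn m *_) (trans (sgn-+ n n) (sgn*sgn≡1 n)) ⟩
  sgn m * + 1             ≡⟨ ℤP.*-identityʳ (sgn m) ⟩
  sgn m                   ∎
  where open ≡-Reasoning

sgn-parity : ∀ m m′ n n′ → m ℕ.+ (n ℕ.+ n) ≡ m′ ℕ.+ (n′ ℕ.+ n′) → sgn m ≡ sgn m′
sgn-parity m m′ n n′ eq =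
  trans (sym (sgn-+-double m n)) (trans (cong sgn eq) (sgn-+-double m′ n′))

sgn[n+m+n]≡sgn[m] : ∀ m n → sgn (n ℕ.+ m ℕ.+ n) ≡ sgn m
sgn[n+m+n]≡sgn[m] m n = trans (cong sgn (ℕP.+-comm (n ℕ.+ m) n)) (trans (cong sgn (sym (ℕP.+-assoc n n m)))
  (trans (cong sgn (ℕP.+-comm (n ℕ.+ n) m)) (sgn-+-double m n)))

∣sgn∣≡1 : ∀ n → ℤ.∣ sgn n ∣ ≡ 1
∣sgn∣≡1 zero    = refl
∣sgn∣≡1 (suc n) = trans (ℤP.∣-i∣≡∣i∣ (sgn n)) (∣sgn∣≡1 n)

pascal : ∀ n k → suc n C suc k ≡ n C k ℕ.+ n C suc k
pascal n k = sym (nCk+nC[k+1]≡[n+1]C[k+1] n k)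

C-sym : ∀ a b {n} → a ℕ.+ b ≡ n → n C a ≡ n C b
C-sym a b refl = trans (nCk≡nC[n∸k] (ℕP.m≤m+n a b)) (cong ((a ℕ.+ b) C_) (ℕP.m+n∸m≡n a b))

C-absorb : ∀ n k → suc k ℕ.* (suc n C suc k) ≡ suc n ℕ.* (n C k)
C-absorb zero    zero    = refl
C-absorb zero    (suc k) = trans (cong (suc (suc k) ℕ.*_) (k>n⇒nCk≡0 (s≤s (s≤s (z≤n {k}))))) (ℕP.*-zeroʳ (suc (suc k)))
C-absorb (suc n) zero    = trans (ℕP.*-identityˡ _) (trans (nC1≡n (suc (suc n))) (sym (ℕP.*-identityʳ _)))
C-absorb (suc n) (suc k) = begin
  suc (suc k) ℕ.* (suc (suc n) C suc (suc k))
    ≡⟨ cong (suc (suc k) ℕ.*_) (pascal (suc n) (suc k)) ⟩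
  suc (suc k) ℕ.* (X ℕ.+ Y)
    ≡⟨ expand (suc k) X Y ⟩
  X ℕ.+ (suc k ℕ.* X ℕ.+ suc (suc k) ℕ.* Y)
    ≡⟨ cong₂ (λ u v → X ℕ.+ (u ℕ.+ v)) (C-absorb n k) (C-absorb n (suc k)) ⟩
  X ℕ.+ (suc n ℕ.* (n C k) ℕ.+ suc n ℕ.* (n C suc k))
    ≡⟨ cong (X ℕ.+_) (trans (sym (ℕP.*-distribˡ-+ (suc n) (n C k) (n C suc k))) (cong (suc n ℕ.*_) (sym (pascal n k)))) ⟩
  suc (suc n) ℕ.* X
    ∎
  where
  open ≡-Reasoning
  X Y : ℕ
  X = suc n C suc k
  Y = suc n C suc (suc k)
  expand : ∀ s x y → suc s ℕ.* (x ℕ.+ y) ≡ x ℕ.+ (s ℕ.* x ℕ.+ suc s ℕ.* y)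
  expand = ℕSolver.solve-∀

p∤nCk : ∀ {p n k} → Prime p → k ℕ.≤ n → n ℕ.< p → ¬ p ℕ∣.∣ n C k
p∤nCk {p} {k = zero} p-prime _ _ p∣1 =
  ℕP.<⇒≱ (ℕ.nonTrivial⇒n>1 p {{prime⇒nonTrivial p-prime}}) (ℕ∣.∣⇒≤ p∣1)
p∤nCk {p} {suc n} {suc k} p-prime (s≤s k≤n) n<p p∣C
  with euclidsLemma (suc n) (n C k) p-prime (subst (p ℕ∣.∣_) (C-absorb n k) (ℕ∣.∣n⇒∣m*n (suc k) p∣C))
... | inj₁ p∣n = ℕP.<⇒≱ n<p (ℕ∣.∣⇒≤ p∣n)
... | inj₂ p∣C′ = p∤nCk p-prime k≤n (ℕP.<-trans (ℕP.n<1+n n) n<p) p∣C′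

-- binom z k = z (z - 1) ⋯ (z - k + 1) / k!, that is (-1)ᵏ C(n + k, k) at z = -1 - n.
binom : ℤ → ℕ → ℤ
binom (+ n)    k = + (n C k)
binom -[1+ n ] k = sgn k * + ((n ℕ.+ k) C k)

binom-0 : ∀ z → binom z 0 ≡ + 1
binom-0 (+ n)    = refl
binom-0 -[1+ n ] = refl

binom-pascal : ∀ z k → binom z (suc k) ≡ binom (z - + 1) (suc k) + binom (z - + 1) k
binom-pascal (+ zero) k = sym (begin
  - sgn k * + (suc k C suc k) + sgn k * + (k C k)
    ≡⟨ cong₂ (λ u v → - sgn k * + u + sgn k * + v) (nCn≡1 (suc k)) (nCn≡1 k) ⟩
  - sgn k * + 1 + sgn k * + 1
    ≡⟨ -s+s≡0 (sgn k) ⟩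
  + 0
    ∎)
  where
  open ≡-Reasoning
  -s+s≡0 : ∀ s → - s * + 1 + s * + 1 ≡ + 0
  -s+s≡0 = solve-∀
binom-pascal (+ suc n) k =
  trans (cong +_ (pascal n k)) (trans (ℤP.pos-+ (n C k) (n C suc k)) (ℤP.+-comm (+ (n C k)) (+ (n C suc k))))
binom-pascal -[1+ n ] k = begin
  - sgn k * + Y
    ≡⟨ rearrange (sgn k) (+ X) (+ Y) ⟩
  - sgn k * (+ X + + Y) + sgn k * + X
    ≡⟨ cong (λ t → - sgn k * t + sgn k * + X) (sym (trans (cong +_ (pascal _ k)) (ℤP.pos-+ X Y))) ⟩
  - sgn k * + ((suc n ℕ.+ suc k) C suc k) + sgn k * + X
    ≡⟨ cong (λ t → - sgn k * + ((suc n ℕ.+ suc k) C suc k) + sgn k * + (t C k)) (ℕP.+-suc n k) ⟩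
  binom -[1+ suc n ] (suc k) + binom -[1+ suc n ] k
    ≡⟨ cong (λ t → binom -[1+ suc t ] (suc k) + binom -[1+ suc t ] k) (sym (ℕP.+-identityʳ n)) ⟩
  binom (-[1+ n ] - + 1) (suc k) + binom (-[1+ n ] - + 1) k
    ∎
  where
  open ≡-Reasoning
  X Y : ℕ
  X = (n ℕ.+ suc k) C k
  Y = (n ℕ.+ suc k) C suc k
  rearrange : ∀ s x y → - s * y ≡ - s * (x + y) + s * x
  rearrange = solve-∀

+m-+n≡+o : ∀ {m} n o → n ℕ.+ o ≡ m → + m - + n ≡ + o
+m-+n≡+o n o refl = trans (cong (_- + n) (ℤP.pos-+ n o)) (cancel (+ n) (+ o))
  where
  cancel : ∀ n o → n + o - n ≡ o
  cancel = solve-∀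

+a-+b≡+c-+d : ∀ a b c d → a ℕ.+ d ≡ c ℕ.+ b → + a - + b ≡ + c - + d
+a-+b≡+c-+d a b c d a+d≡c+b = begin
  + a - + b                 ≡⟨ pad (+ a) (+ b) (+ d) ⟩
  + a + + d - (+ b + + d)   ≡⟨ cong (_- (+ b + + d)) (trans (sym (ℤP.pos-+ a d)) (trans (cong +_ a+d≡c+b) (ℤP.pos-+ c b))) ⟩
  + c + + b - (+ b + + d)   ≡⟨ unpad (+ c) (+ b) (+ d) ⟩
  + c - + d                 ∎
  where
  open ≡-Reasoning
  pad : ∀ a b d → a - b ≡ a + d - (b + d)
  pad = solve-∀
  unpad : ∀ c b d → c + b - (b + d) ≡ c - d
  unpad = solve-∀

+m-+[1+m+n]≡-[1+n] : ∀ m n → + m - + (suc m ℕ.+ n) ≡ -[1+ n ]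
+m-+[1+m+n]≡-[1+n] m n = trans (cong (λ t → + m - t) (ℤP.pos-+ (suc m) n)) (cancel (+ m) (+ n))
  where
  cancel : ∀ m n → m - ((+ 1 + m) + n) ≡ - (+ 1 + n)
  cancel = solve-∀

binomℤ-reflect : ∀ N i → binomℤ N (+ N - + i) ≡ + (N C i)
binomℤ-reflect N i with i ℕ.≤? N
... | yes i≤N with ℕP.m≤n⇒∃[o]m+o≡n i≤N
...   | j , refl = trans (cong (binomℤ (i ℕ.+ j)) (+m-+n≡+o i j refl)) (cong +_ (C-sym j i (ℕP.+-comm j i)))
binomℤ-reflect N i | no i≰N with ℕP.m≤n⇒∃[o]m+o≡n (ℕP.≰⇒> i≰N)
... | j , refl = trans (cong (binomℤ N) (+m-+[1+m+n]≡-[1+n] N j)) (cong +_ (sym (k>n⇒nCk≡0 (ℕP.≰⇒> i≰N))))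

m+n≡o⇒o∸m≡n : ∀ m {n o} → m ℕ.+ n ≡ o → o ℕ.∸ m ≡ n
m+n≡o⇒o∸m≡n m {n} refl = ℕP.m+n∸m≡n m n

∑ : ℕ → (ℕ → ℤ) → ℤ
∑ zero    f = + 0
∑ (suc n) f = ∑ n f + f n

∑-cong : ∀ n {f g : ℕ → ℤ} → (∀ i → i ℕ.< n → f i ≡ g i) → ∑ n f ≡ ∑ n g
∑-cong zero    f≡g = refl
∑-cong (suc n) f≡g = cong₂ _+_ (∑-cong n (λ i i<n → f≡g i (ℕP.m<n⇒m<1+n i<n))) (f≡g n (ℕP.n<1+n n))

∑-zero : ∀ n (f : ℕ → ℤ) → (∀ i → i ℕ.< n → f i ≡ + 0) → ∑ n f ≡ + 0
∑-zero zero    f f≡0 = refl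
∑-zero (suc n) f f≡0 = cong₂ _+_ (∑-zero n f (λ i i<n → f≡0 i (ℕP.m<n⇒m<1+n i<n))) (f≡0 n (ℕP.n<1+n n))

∑-+ : ∀ n (f g : ℕ → ℤ) → ∑ n (λ i → f i + g i) ≡ ∑ n f + ∑ n g
∑-+ zero    f g = refl
∑-+ (suc n) f g = trans (cong (_+ (f n + g n)) (∑-+ n f g)) (interchange (∑ n f) (∑ n g) (f n) (g n))
  where
  interchange : ∀ a b c d → a + b + (c + d) ≡ a + c + (b + d)
  interchange = solve-∀

∑-*ˡ : ∀ n (c : ℤ) (f : ℕ → ℤ) → ∑ n (λ i → c * f i) ≡ c * ∑ n f
∑-*ˡ zero    c f = sym (ℤP.*-zeroʳ c)
∑-*ˡ (suc n) c f = trans (cong (_+ (c * f n)) (∑-*ˡ n c f)) (sym (ℤP.*-distribˡ-+ c (∑ n f) (f n)))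

∑-split : ∀ m n (f : ℕ → ℤ) → ∑ (m ℕ.+ n) f ≡ ∑ m f + ∑ n (λ i → f (m ℕ.+ i))
∑-split m zero    f = trans (cong (λ t → ∑ t f) (ℕP.+-identityʳ m)) (sym (ℤP.+-identityʳ _))
∑-split m (suc n) f =
  trans (cong (λ t → ∑ t f) (ℕP.+-suc m n)) (trans (cong (_+ f (m ℕ.+ n)) (∑-split m n f)) (ℤP.+-assoc (∑ m f) _ _))

∑-front : ∀ n (f : ℕ → ℤ) → ∑ (suc n) f ≡ f 0 + ∑ n (λ i → f (suc i))
∑-front n f = trans (∑-split 1 n f) (cong (_+ ∑ n (λ i → f (suc i))) (ℤP.+-identityˡ (f 0)))

sumFrom1≡∑ : ∀ n (f : ℕ → ℤ) → sumFrom1 n f ≡ ∑ n (λ i → f (suc i))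
sumFrom1≡∑ zero    f = refl
sumFrom1≡∑ (suc n) f = cong (_+ f (suc n)) (sumFrom1≡∑ n f)

∑-C-pascal : ∀ m (a : ℕ → ℤ) → ∑ (suc (suc m)) (λ v → + (suc m C v) * a v)
             ≡ ∑ (suc m) (λ v → + (m C v) * a v) + ∑ (suc m) (λ v → + (m C v) * a (suc v))
∑-C-pascal m a = begin
  ∑ (suc (suc m)) (λ v → + (suc m C v) * a v)
    ≡⟨ ∑-front (suc m) _ ⟩
  + 1 * a 0 + ∑ (suc m) (λ v → + (suc m C suc v) * a (suc v))
    ≡⟨ cong (_+_ (+ 1 * a 0)) (∑-cong (suc m) λ v _ → split-coefficient v) ⟩
  + 1 * a 0 + ∑ (suc m) (λ v → + (m C v) * a (suc v) + + (m C suc v) * a (suc v))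
    ≡⟨ cong (_+_ (+ 1 * a 0)) (∑-+ (suc m) _ _) ⟩
  + 1 * a 0 + (S + (T + + (m C suc m) * a (suc m)))
    ≡⟨ cong (λ t → + 1 * a 0 + (S + (T + + t * a (suc m)))) (k>n⇒nCk≡0 (ℕP.n<1+n m)) ⟩
  + 1 * a 0 + (S + (T + + 0 * a (suc m)))
    ≡⟨ regroup (+ 1 * a 0) S T (a (suc m)) ⟩
  (+ 1 * a 0 + T) + S
    ≡⟨ cong (_+ S) (sym (∑-front m _)) ⟩
  ∑ (suc m) (λ v → + (m C v) * a v) + S
    ∎
  where
  open ≡-Reasoning
  S T : ℤ
  S = ∑ (suc m) (λ v → + (m C v) * a (suc v))
  T = ∑ m (λ v → + (m C suc v) * a (suc v))
  split-coefficient : ∀ v → + (suc m C suc v) * a (suc v) ≡ + (m C v) * a (suc v) + + (m C suc v) * a (suc v)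
  split-coefficient v =
    trans (cong (λ t → + t * a (suc v)) (pascal m v))
          (trans (cong (_* a (suc v)) (ℤP.pos-+ (m C v) (m C suc v))) (ℤP.*-distribʳ-+ (a (suc v)) (+ (m C v)) (+ (m C suc v))))
  regroup : ∀ t s u z → t + (s + (u + + 0 * z)) ≡ (t + u) + s
  regroup = solve-∀

∇ : (ℤ → ℤ) → ℤ → ℤ
∇ g y = g y - g (y - + 1)

∇^ : ℕ → (ℤ → ℤ) → ℤ → ℤ
∇^ zero    g = g
∇^ (suc m) g = ∇^ m (∇ g)

∇^-cong : ∀ m {g h : ℤ → ℤ} → (∀ y → g y ≡ h y) → ∀ x → ∇^ m g x ≡ ∇^ m h x
∇^-cong zero    g≡h x = g≡h x
∇^-cong (suc m) g≡h x = ∇^-cong m (λ y → cong₂ _-_ (g≡h y) (g≡h (y - + 1))) x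

∇^-+ : ∀ m (g h : ℤ → ℤ) x → ∇^ m (λ y → g y + h y) x ≡ ∇^ m g x + ∇^ m h x
∇^-+ zero    g h x = refl
∇^-+ (suc m) g h x = trans (∇^-cong m (λ y → interchange (g y) (h y) (g (y - + 1)) (h (y - + 1))) x) (∇^-+ m (∇ g) (∇ h) x)
  where
  interchange : ∀ a b c d → a + b - (c + d) ≡ (a - c) + (b - d)
  interchange = solve-∀

∇^-expand : ∀ m (g : ℤ → ℤ) x → ∇^ m g x ≡ ∑ (suc m) (λ v → sgn v * + (m C v) * g (x - + v))
∇^-expand zero    g x = trans (cong g (sym (ℤP.+-identityʳ x))) (unit (g (x - + 0)))
  where
  unit : ∀ u → u ≡ + 0 + + 1 * + 1 * u
  unit = solve-∀
∇^-expand (suc m) g x = begin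
  ∇^ m (∇ g) x
    ≡⟨ ∇^-expand m (∇ g) x ⟩
  ∑ (suc m) (λ v → sgn v * + (m C v) * ∇ g (x - + v))
    ≡⟨ ∑-cong (suc m) (λ v _ → split-term v) ⟩
  ∑ (suc m) (λ v → + (m C v) * a v + + (m C v) * a (suc v))
    ≡⟨ ∑-+ (suc m) _ _ ⟩
  ∑ (suc m) (λ v → + (m C v) * a v) + ∑ (suc m) (λ v → + (m C v) * a (suc v))
    ≡⟨ sym (∑-C-pascal m a) ⟩
  ∑ (suc (suc m)) (λ v → + (suc m C v) * a v)
    ≡⟨ ∑-cong (suc (suc m)) (λ v _ → reorder (sgn v) (+ (suc m C v)) (g (x - + v))) ⟩
  ∑ (suc (suc m)) (λ v → sgn v * + (suc m C v) * g (x - + v))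
    ∎
  where
  open ≡-Reasoning
  a : ℕ → ℤ
  a v = sgn v * g (x - + v)
  split-term : ∀ v → sgn v * + (m C v) * ∇ g (x - + v) ≡ + (m C v) * a v + + (m C v) * a (suc v)
  split-term v = trans (cong (λ t → sgn v * + (m C v) * (g (x - + v) - g t)) (shift x (+ v)))
                       (distribute (sgn v) (+ (m C v)) (g (x - + v)) (g (x - + suc v)))
    where
    shift : ∀ x v → x - v - + 1 ≡ x - (+ 1 + v)
    shift = solve-∀
    distribute : ∀ s b u w → s * b * (u - w) ≡ b * (s * u) + b * (- s * w)
    distribute = solve-∀
  reorder : ∀ s b u → b * (s * u) ≡ s * b * u
  reorder = solve-∀

∇-* : ∀ (u v : ℤ → ℤ) y → ∇ (λ y → u y * v y) y ≡ ∇ u y * v y + u (y - + 1) * ∇ v y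
∇-* u v y = leibniz (u y) (u (y - + 1)) (v y) (v (y - + 1))
  where
  leibniz : ∀ a a′ b b′ → a * b - a′ * b′ ≡ (a - a′) * b + a′ * (b - b′)
  leibniz = solve-∀

∇-binom : ∀ α k y → ∇ (λ y → binom (y + α) (suc k)) y ≡ binom (y + (α - + 1)) k
∇-binom α k y = begin
  binom (y + α) (suc k) - binom (y - + 1 + α) (suc k)
    ≡⟨ cong₂ (λ u w → u - binom w (suc k)) (binom-pascal (y + α) k) (reassociate y α) ⟩
  binom (y + α - + 1) (suc k) + binom (y + α - + 1) k - binom (y + α - + 1) (suc k)
    ≡⟨ cancel (binom (y + α - + 1) (suc k)) (binom (y + α - + 1) k) ⟩
  binom (y + α - + 1) k
    ≡⟨ cong (λ z → binom z k) (ℤP.+-assoc y α (- + 1)) ⟩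
  binom (y + (α - + 1)) k
    ∎
  where
  open ≡-Reasoning
  reassociate : ∀ y α → y - + 1 + α ≡ y + α - + 1
  reassociate = solve-∀
  cancel : ∀ a b → a + b - a ≡ b
  cancel = solve-∀

∇-binom-0 : ∀ α y → ∇ (λ y → binom (y + α) 0) y ≡ + 0
∇-binom-0 α y = cong₂ _-_ (binom-0 (y + α)) (binom-0 (y - + 1 + α))

∇-binom*binom : ∀ α β k l y →
  ∇ (λ y → binom (y + α) k * binom (y + β) l) y
  ≡ ∇ (λ y → binom (y + α) k) y * binom (y + β) l + binom (y + (α - + 1)) k * ∇ (λ y → binom (y + β) l) y
∇-binom*binom α β k l y =
  trans (∇-* (λ y → binom (y + α) k) (λ y → binom (y + β) l) y)
        (cong (λ t → ∇ (λ y → binom (y + α) k) y * binom (y + β) l + binom t k * ∇ (λ y → binom (y + β) l) y)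
              (reassociate y α))
  where
  reassociate : ∀ y α → y - + 1 + α ≡ y + (α - + 1)
  reassociate = solve-∀

∇-binom₀*binom : ∀ α β l y →
  ∇ (λ y → binom (y + α) 0 * binom (y + β) (suc l)) y ≡ binom (y + α) 0 * binom (y + (β - + 1)) l
∇-binom₀*binom α β l y = begin
  ∇ (λ y → binom (y + α) 0 * binom (y + β) (suc l)) y
    ≡⟨ ∇-binom*binom α β 0 (suc l) y ⟩
  ∇ (λ y → binom (y + α) 0) y * binom (y + β) (suc l) + binom (y + (α - + 1)) 0 * ∇ (λ y → binom (y + β) (suc l)) y
    ≡⟨ cong₂ (λ u w → u * binom (y + β) (suc l) + w) (∇-binom-0 α y)
             (cong₂ _*_ (trans (binom-0 (y + (α - + 1))) (sym (binom-0 (y + α)))) (∇-binom β l y)) ⟩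
  + 0 * binom (y + β) (suc l) + binom (y + α) 0 * binom (y + (β - + 1)) l
    ≡⟨ ℤP.+-identityˡ _ ⟩
  binom (y + α) 0 * binom (y + (β - + 1)) l
    ∎
  where open ≡-Reasoning

∇-binom*binom₀ : ∀ α β k y →
  ∇ (λ y → binom (y + α) (suc k) * binom (y + β) 0) y ≡ binom (y + (α - + 1)) k * binom (y + β) 0
∇-binom*binom₀ α β k y = begin
  ∇ (λ y → binom (y + α) (suc k) * binom (y + β) 0) y
    ≡⟨ ∇-binom*binom α β (suc k) 0 y ⟩
  ∇ (λ y → binom (y + α) (suc k)) y * binom (y + β) 0 + binom (y + (α - + 1)) (suc k) * ∇ (λ y → binom (y + β) 0) y
    ≡⟨ cong₂ (λ u w → u * binom (y + β) 0 + binom (y + (α - + 1)) (suc k) * w) (∇-binom α k y) (∇-binom-0 β y) ⟩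
  binom (y + (α - + 1)) k * binom (y + β) 0 + binom (y + (α - + 1)) (suc k) * + 0
    ≡⟨ drop-zero (binom (y + (α - + 1)) k * binom (y + β) 0) (binom (y + (α - + 1)) (suc k)) ⟩
  binom (y + (α - + 1)) k * binom (y + β) 0
    ∎
  where
  open ≡-Reasoning
  drop-zero : ∀ a b → a + b * + 0 ≡ a
  drop-zero = solve-∀

∇-binom*binom-suc : ∀ α β k l y →
  ∇ (λ y → binom (y + α) (suc k) * binom (y + β) (suc l)) y
  ≡ binom (y + (α - + 1)) k * binom (y + β) (suc l) + binom (y + (α - + 1)) (suc k) * binom (y + (β - + 1)) l
∇-binom*binom-suc α β k l y =
  trans (∇-binom*binom α β (suc k) (suc l) y)
        (cong₂ (λ u w → u * binom (y + β) (suc l) + binom (y + (α - + 1)) (suc k) * w) (∇-binom α k y) (∇-binom β l y))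

∇^-binom*binom : ∀ m k l α β x → k ℕ.+ l ≡ m → ∇^ m (λ y → binom (y + α) k * binom (y + β) l) x ≡ + (m C k)
∇^-binom*binom zero zero zero α β x refl = cong₂ _*_ (binom-0 (x + α)) (binom-0 (x + β))
∇^-binom*binom (suc m) zero .(suc m) α β x refl =
  trans (∇^-cong m (∇-binom₀*binom α β m) x) (∇^-binom*binom m zero m α (β - + 1) x refl)
∇^-binom*binom (suc m) (suc k) zero α β x 1+k+0≡1+m =
  trans (∇^-cong m (∇-binom*binom₀ α β k) x)
        (trans (∇^-binom*binom m k zero (α - + 1) β x k+0≡m) (cong +_ mCk≡[1+m]C[1+k]))
  where
  k+0≡m : k ℕ.+ 0 ≡ m
  k+0≡m = ℕP.suc-injective 1+k+0≡1+m
  mCk≡[1+m]C[1+k] : m C k ≡ suc m C suc k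
  mCk≡[1+m]C[1+k] = sym (trans (pascal m k) (trans (cong (m C k ℕ.+_) (k>n⇒nCk≡0 m<1+k)) (ℕP.+-identityʳ (m C k))))
    where
    m<1+k : m ℕ.< suc k
    m<1+k = ℕP.≤-reflexive (cong suc (trans (sym k+0≡m) (ℕP.+-identityʳ k)))
∇^-binom*binom (suc m) (suc k) (suc l) α β x 1+k+1+l≡1+m = begin
  ∇^ m (∇ (λ y → binom (y + α) (suc k) * binom (y + β) (suc l))) x
    ≡⟨ ∇^-cong m (∇-binom*binom-suc α β k l) x ⟩
  ∇^ m (λ y → binom (y + (α - + 1)) k * binom (y + β) (suc l) + binom (y + (α - + 1)) (suc k) * binom (y + (β - + 1)) l) x
    ≡⟨ ∇^-+ m _ _ x ⟩
  ∇^ m (λ y → binom (y + (α - + 1)) k * binom (y + β) (suc l)) x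
    + ∇^ m (λ y → binom (y + (α - + 1)) (suc k) * binom (y + (β - + 1)) l) x
    ≡⟨ cong₂ _+_ (∇^-binom*binom m k (suc l) (α - + 1) β x k+1+l≡m)
                 (∇^-binom*binom m (suc k) l (α - + 1) (β - + 1) x (trans (sym (ℕP.+-suc k l)) k+1+l≡m)) ⟩
  + (m C k) + + (m C suc k)
    ≡⟨ sym (trans (cong +_ (pascal m k)) (ℤP.pos-+ (m C k) (m C suc k))) ⟩
  + (suc m C suc k)
    ∎
  where
  open ≡-Reasoning
  k+1+l≡m : k ℕ.+ suc l ≡ m
  k+1+l≡m = ℕP.suc-injective 1+k+1+l≡1+m

module Congruence (p : ℕ) where

  infix 4 _≈_
  record _≈_ (a b : ℤ) : Set where
    constructor mk≈
    field p∣a-b : + p ℤ∣.∣ a - b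
  open _≈_ public

  ≈-reflexive : ∀ {a b} → a ≡ b → a ≈ b
  ≈-reflexive {a} refl = mk≈ (ℤ∣.divides (+ 0) (trans (ℤP.+-inverseʳ a) (sym (ℤP.*-zeroˡ (+ p)))))

  ≈-sym : ∀ {a b} → a ≈ b → b ≈ a
  ≈-sym {a} {b} (mk≈ p∣a-b) = mk≈ (subst (+ p ℤ∣.∣_) (negate-difference a b) (ℤ∣.∣m⇒∣-m p∣a-b))
    where
    negate-difference : ∀ a b → - (a - b) ≡ b - a
    negate-difference = solve-∀

  ≈-trans : ∀ {a b c} → a ≈ b → b ≈ c → a ≈ c
  ≈-trans {a} {b} {c} (mk≈ p∣a-b) (mk≈ p∣b-c) = mk≈ (subst (+ p ℤ∣.∣_) (telescope a b c) (ℤ∣.∣m∣n⇒∣m+n p∣a-b p∣b-c))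
    where
    telescope : ∀ a b c → (a - b) + (b - c) ≡ a - c
    telescope = solve-∀

  ≈-setoid : Setoid _ _
  ≈-setoid = record
    { Carrier       = ℤ
    ; _≈_           = _≈_
    ; isEquivalence = record { refl = ≈-reflexive refl ; sym = ≈-sym ; trans = ≈-trans }
    }

  module ≈-Reasoning = Relation.Binary.Reasoning.Setoid ≈-setoid

  +-cong : ∀ {a b c d} → a ≈ b → c ≈ d → a + c ≈ b + d
  +-cong {a} {b} {c} {d} (mk≈ p∣a-b) (mk≈ p∣c-d) = mk≈ (subst (+ p ℤ∣.∣_) (regroup a b c d) (ℤ∣.∣m∣n⇒∣m+n p∣a-b p∣c-d))
    where
    regroup : ∀ a b c d → (a - b) + (c - d) ≡ (a + c) - (b + d)
    regroup = solve-∀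

  *-congˡ : ∀ c {a b} → a ≈ b → c * a ≈ c * b
  *-congˡ c {a} {b} (mk≈ p∣a-b) = mk≈ (subst (+ p ℤ∣.∣_) (distrib c a b) (ℤ∣.∣n⇒∣m*n c p∣a-b))
    where
    distrib : ∀ c a b → c * (a - b) ≡ c * a - c * b
    distrib = solve-∀

  ∑-reverse : ∀ n (f g : ℕ → ℤ) → (∀ a b → suc (a ℕ.+ b) ≡ n → f a ≈ g b) → ∑ n f ≈ ∑ n g
  ∑-reverse zero    f g f≈g = ≈-reflexive refl
  ∑-reverse (suc n) f g f≈g = begin
    ∑ (suc n) f                     ≡⟨ ∑-front n f ⟩
    f 0 + ∑ n (λ i → f (suc i))     ≈⟨ +-cong (f≈g 0 n refl) (∑-reverse n _ g λ a b eq → f≈g (suc a) b (cong suc eq)) ⟩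
    g n + ∑ n g                     ≡⟨ ℤP.+-comm (g n) (∑ n g) ⟩
    ∑ (suc n) g                     ∎
    where open ≈-Reasoning

module _ {p : ℕ} (p-prime : Prime p) where
  open Congruence p

  p∣[1+u]*z⇒p∣z : ∀ u {z} → suc u ℕ.< p → + p ℤ∣.∣ + suc u * z → + p ℤ∣.∣ z
  p∣[1+u]*z⇒p∣z u {z} 1+u<p p∣uz
    with euclidsLemma (suc u) ℤ.∣ z ∣ p-prime (subst (p ℕ∣.∣_) (ℤP.abs-* (+ suc u) z) (ℤ∣.∣⇒∣ᵤ p∣uz))
  ... | inj₁ p∣1+u = ⊥-elim (ℕP.<⇒≱ 1+u<p (ℕ∣.∣⇒≤ p∣1+u))
  ... | inj₂ p∣z   = ℤ∣.∣ᵤ⇒∣ p∣z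

  sgn*nCk≉0 : ∀ s {n k} → k ℕ.≤ n → n ℕ.< p → ¬ (sgn s * + (n C k) ≈ + 0)
  sgn*nCk≉0 s {n} {k} k≤n n<p (mk≈ p∣x-0) = p∤nCk p-prime k≤n n<p (subst (p ℕ∣.∣_) ∣x-0∣≡nCk (ℤ∣.∣⇒∣ᵤ p∣x-0))
    where
    ∣x-0∣≡nCk : ℤ.∣ sgn s * + (n C k) - + 0 ∣ ≡ n C k
    ∣x-0∣≡nCk = begin
      ℤ.∣ sgn s * + (n C k) - + 0 ∣     ≡⟨ cong ℤ.∣_∣ (ℤP.+-identityʳ (sgn s * + (n C k))) ⟩
      ℤ.∣ sgn s * + (n C k) ∣           ≡⟨ ℤP.abs-* (sgn s) (+ (n C k)) ⟩
      ℤ.∣ sgn s ∣ ℕ.* (n C k)           ≡⟨ cong (ℕ._* (n C k)) (∣sgn∣≡1 s) ⟩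
      1 ℕ.* (n C k)                     ≡⟨ ℕP.*-identityˡ (n C k) ⟩
      n C k                             ∎
      where open ≡-Reasoning

  -- N ≡ -(r + 1) modulo p, so C(N, i) ≡ C(-(r + 1), i) = (-1)ⁱ C(r + i, i) as long as i! is invertible.
  NCi≈sgn*[i+r]Ci : ∀ {N r} → N ℕ.+ suc r ≡ p → ∀ i → i ℕ.< p → + (N C i) ≈ sgn i * + ((i ℕ.+ r) C i)
  NCi≈sgn*[i+r]Ci         N+1+r≡p zero    _   = ≈-reflexive refl
  NCi≈sgn*[i+r]Ci {N} {r} N+1+r≡p (suc i) i<p =
    mk≈ (p∣[1+u]*z⇒p∣z i i<p (subst (+ p ℤ∣.∣_) (sym recurrence) p∣rhs))
    where
    X X′ B B′ s : ℤ
    X  = + (N C i)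
    X′ = + (N C suc i)
    B  = + ((i ℕ.+ r) C i)
    B′ = + ((suc i ℕ.+ r) C suc i)
    s  = sgn i

    row : + suc i * (X + X′) ≡ + suc N * X
    row = begin
      + suc i * (X + X′)                  ≡⟨ sym (ℤP.pos-* (suc i) (N C i ℕ.+ N C suc i)) ⟩
      + (suc i ℕ.* (N C i ℕ.+ N C suc i)) ≡⟨ cong (λ t → + (suc i ℕ.* t)) (sym (pascal N i)) ⟩
      + (suc i ℕ.* (suc N C suc i))       ≡⟨ cong +_ (C-absorb N i) ⟩
      + (suc N ℕ.* (N C i))               ≡⟨ ℤP.pos-* (suc N) (N C i) ⟩
      + suc N * X                         ∎
      where open ≡-Reasoning

    column : + suc i * B′ ≡ + suc (i ℕ.+ r) * B
    column = trans (sym (ℤP.pos-* (suc i) _)) (trans (cong +_ (C-absorb (i ℕ.+ r) i)) (ℤP.pos-* (suc (i ℕ.+ r)) _))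

    p≡N-i+[i+r+1] : + suc N - + suc i + + suc (i ℕ.+ r) ≡ + p
    p≡N-i+[i+r+1] = trans (regroup (+ N) (+ i) (+ r)) (cong +_ N+1+r≡p)
      where
      regroup : ∀ N i r → (+ 1 + N) - (+ 1 + i) + (+ 1 + (i + r)) ≡ N + (+ 1 + r)
      regroup = solve-∀

    recurrence : + suc i * (X′ - - s * B′) ≡ (+ suc N - + suc i) * (X - s * B) + + p * (s * B)
    recurrence = begin
      + suc i * (X′ - - s * B′)
        ≡⟨ expand (+ suc i) X X′ s B′ ⟩
      + suc i * (X + X′) - + suc i * X + s * (+ suc i * B′)
        ≡⟨ cong₂ (λ u v → u - + suc i * X + s * v) row column ⟩
      + suc N * X - + suc i * X + s * (+ suc (i ℕ.+ r) * B)
        ≡⟨ collect (+ suc N) (+ suc i) (+ suc (i ℕ.+ r)) X s B ⟩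
      (+ suc N - + suc i) * (X - s * B) + (+ suc N - + suc i + + suc (i ℕ.+ r)) * (s * B)
        ≡⟨ cong (λ t → (+ suc N - + suc i) * (X - s * B) + t * (s * B)) p≡N-i+[i+r+1] ⟩
      (+ suc N - + suc i) * (X - s * B) + + p * (s * B)
        ∎
      where
      open ≡-Reasoning
      expand : ∀ u x x′ s b′ → u * (x′ - - s * b′) ≡ u * (x + x′) - u * x + s * (u * b′)
      expand = solve-∀
      collect : ∀ n u q x s b → n * x - u * x + s * (q * b) ≡ (n - u) * (x - s * b) + (n - u + q) * (s * b)
      collect = solve-∀

    p∣rhs : + p ℤ∣.∣ (+ suc N - + suc i) * (X - s * B) + + p * (s * B)
    p∣rhs = ℤ∣.∣m∣n⇒∣m+n (ℤ∣.∣n⇒∣m*n (+ suc N - + suc i) (p∣a-b induction-hypothesis)) (ℤ∣.∣m⇒∣m*n (s * B) ℤ∣.∣-refl)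
      where
      induction-hypothesis : X ≈ s * B
      induction-hypothesis = NCi≈sgn*[i+r]Ci N+1+r≡p i (ℕP.<-trans (ℕP.n<1+n i) i<p)

  module _ {N r : ℕ} (N+1+r≡p : N ℕ.+ suc r ≡ p) where

    binomℤ[N,t-r]≈ : ∀ t → t ℕ.< p ℕ.+ r → binomℤ N (+ t - + r) ≈ sgn (t ℕ.+ r) * + (t C r)
    binomℤ[N,t-r]≈ t t<p+r with t ℕ.<? r
    ... | yes t<r with ℕP.m≤n⇒∃[o]m+o≡n t<r
    ...   | q , refl = ≈-reflexive (begin
      binomℤ N (+ t - + (suc t ℕ.+ q))   ≡⟨ cong (binomℤ N) (+m-+[1+m+n]≡-[1+n] t q) ⟩
      + 0                                ≡⟨ sym (ℤP.*-zeroʳ (sgn (t ℕ.+ r))) ⟩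
      sgn (t ℕ.+ r) * + 0                ≡⟨ cong (λ z → sgn (t ℕ.+ r) * + z) (sym (k>n⇒nCk≡0 t<r)) ⟩
      sgn (t ℕ.+ r) * + (t C r)          ∎)
      where open ≡-Reasoning
    binomℤ[N,t-r]≈ t t<p+r | no t≮r with ℕP.m≤n⇒∃[o]m+o≡n (ℕP.≮⇒≥ t≮r)
    ... | i , refl = begin
      binomℤ N (+ (r ℕ.+ i) - + r)
        ≡⟨ cong (binomℤ N) (+m-+n≡+o r i refl) ⟩
      + (N C i)
        ≈⟨ NCi≈sgn*[i+r]Ci N+1+r≡p i i<p ⟩
      sgn i * + ((i ℕ.+ r) C i)
        ≡⟨ cong₂ (λ u v → u * + v) (sym (sgn[n+m+n]≡sgn[m] i r))
                 (trans (cong (_C i) (ℕP.+-comm i r)) (C-sym i r (ℕP.+-comm i r))) ⟩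
      sgn (r ℕ.+ i ℕ.+ r) * + ((r ℕ.+ i) C r)
        ∎
      where
      open ≈-Reasoning
      i<p : i ℕ.< p
      i<p = ℕP.+-cancelˡ-< r i p (subst (r ℕ.+ i ℕ.<_) (ℕP.+-comm p r) t<p+r)

    binomℤ[N,p-y]≈ : ∀ y → 1 ℕ.≤ y → y ℕ.≤ p ℕ.+ r → binomℤ N (+ p - + y) ≈ - sgn y * binom (+ r - + y) r
    binomℤ[N,p-y]≈ y 1≤y y≤p+r with y ℕ.≤? r
    ... | yes y≤r with ℕP.m≤n⇒∃[o]m+o≡n y≤r
    ...   | s , refl = ≈-reflexive (begin
      binomℤ N (+ p - + y)                         ≡⟨ cong (λ t → binomℤ N (+ t - + y)) (sym N+1+r≡p) ⟩
      binomℤ N (+ (N ℕ.+ suc (y ℕ.+ s)) - + y)     ≡⟨ cong (binomℤ N) (cancel N y s) ⟩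
      + (N C (N ℕ.+ suc s))                        ≡⟨ cong +_ (k>n⇒nCk≡0 (ℕP.m<m+n N (s≤s z≤n))) ⟩
      + 0                                          ≡⟨ sym (ℤP.*-zeroʳ (- sgn y)) ⟩
      - sgn y * + 0                                ≡⟨ cong (λ z → - sgn y * + z) (sym (k>n⇒nCk≡0 s<y+s)) ⟩
      - sgn y * binom (+ s) (y ℕ.+ s)              ≡⟨ cong (λ z → - sgn y * binom z (y ℕ.+ s)) (sym (+m-+n≡+o y s refl)) ⟩
      - sgn y * binom (+ (y ℕ.+ s) - + y) (y ℕ.+ s) ∎)
      where
      open ≡-Reasoning
      s<y+s : s ℕ.< y ℕ.+ s
      s<y+s = ℕP.m<n+m s 1≤y
      cancel : ∀ N y s → + (N ℕ.+ suc (y ℕ.+ s)) - + y ≡ + (N ℕ.+ suc s)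
      cancel N y s = +m-+n≡+o y (N ℕ.+ suc s) (identity y N s)
        where
        identity : ∀ y N s → y ℕ.+ (N ℕ.+ suc s) ≡ N ℕ.+ suc (y ℕ.+ s)
        identity = ℕSolver.solve-∀
    binomℤ[N,p-y]≈ y 1≤y y≤p+r | no y≰r with ℕP.m≤n⇒∃[o]m+o≡n (ℕP.≰⇒> y≰r)
    ... | i , refl = begin
      binomℤ N (+ p - + (suc r ℕ.+ i))
        ≡⟨ cong (λ t → binomℤ N (+ t - + (suc r ℕ.+ i))) (sym N+1+r≡p) ⟩
      binomℤ N (+ (N ℕ.+ suc r) - + (suc r ℕ.+ i))
        ≡⟨ cong (binomℤ N) (cancel N r i) ⟩
      binomℤ N (+ N - + i)
        ≡⟨ binomℤ-reflect N i ⟩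
      + (N C i)
        ≈⟨ NCi≈sgn*[i+r]Ci N+1+r≡p i i<p ⟩
      sgn i * + ((i ℕ.+ r) C i)
        ≡⟨ cong₂ (λ u v → u * + v) (sym (sgn[n+m+n]≡sgn[m] i r)) (C-sym i r refl) ⟩
      sgn (r ℕ.+ i ℕ.+ r) * + ((i ℕ.+ r) C r)
        ≡⟨ cong (_* + ((i ℕ.+ r) C r)) (sgn-+ (r ℕ.+ i) r) ⟩
      sgn (r ℕ.+ i) * sgn r * + ((i ℕ.+ r) C r)
        ≡⟨ ℤP.*-assoc (sgn (r ℕ.+ i)) (sgn r) _ ⟩
      sgn (r ℕ.+ i) * binom -[1+ i ] r
        ≡⟨ cong (_* binom -[1+ i ] r) (sym (ℤP.neg-involutive (sgn (r ℕ.+ i)))) ⟩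
      - sgn (suc r ℕ.+ i) * binom -[1+ i ] r
        ≡⟨ cong (λ z → - sgn (suc r ℕ.+ i) * binom z r) (sym (+m-+[1+m+n]≡-[1+n] r i)) ⟩
      - sgn (suc r ℕ.+ i) * binom (+ r - + (suc r ℕ.+ i)) r
        ∎
      where
      open ≈-Reasoning
      i<p : i ℕ.< p
      i<p = ℕP.+-cancelˡ-≤ r (suc i) p (subst₂ ℕ._≤_ (sym (ℕP.+-suc r i)) (ℕP.+-comm p r) y≤p+r)
      cancel : ∀ N r i → + (N ℕ.+ suc r) - + (suc r ℕ.+ i) ≡ + N - + i
      cancel N r i = +a-+b≡+c-+d (N ℕ.+ suc r) (suc r ℕ.+ i) N i (ℕP.+-assoc N (suc r) i)

module Reduction (K c₁ d₁ e : ℕ) where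

  k c d p n r m N : ℕ
  k = suc K
  c = k ℕ.+ c₁
  d = c ℕ.+ d₁
  p = c ℕ.+ d ℕ.+ e
  n = c₁ ℕ.+ d₁
  r = suc (c₁ ℕ.+ n)
  m = K ℕ.+ r
  N = e ℕ.+ K ℕ.+ K

  N+1+r≡p : N ℕ.+ suc r ≡ p
  N+1+r≡p = identity e K c₁ d₁
    where
    identity : ∀ e K c₁ d₁ → e ℕ.+ K ℕ.+ K ℕ.+ suc (suc (c₁ ℕ.+ (c₁ ℕ.+ d₁)))
                             ≡ suc K ℕ.+ c₁ ℕ.+ (suc K ℕ.+ c₁ ℕ.+ d₁) ℕ.+ e
    identity = ℕSolver.solve-∀

  m<p : m ℕ.< p
  m<p = subst (m ℕ.<_) N+1+r≡p (ℕP.≤-trans (s≤s (ℕP.m≤n+m m (e ℕ.+ K))) (ℕP.≤-reflexive (identity e K r)))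
    where
    identity : ∀ e K r → suc (e ℕ.+ K ℕ.+ (K ℕ.+ r)) ≡ e ℕ.+ K ℕ.+ K ℕ.+ suc r
    identity = ℕSolver.solve-∀

  c+d∸k≡m : c ℕ.+ d ℕ.∸ k ≡ m
  c+d∸k≡m = m+n≡o⇒o∸m≡n k (identity K c₁ d₁)
    where
    identity : ∀ K c₁ d₁ → suc K ℕ.+ (K ℕ.+ suc (c₁ ℕ.+ (c₁ ℕ.+ d₁))) ≡ suc K ℕ.+ c₁ ℕ.+ (suc K ℕ.+ c₁ ℕ.+ d₁)
    identity = ℕSolver.solve-∀

  p+2k∸[c+d]∸2≡N : p ℕ.+ 2 ℕ.* k ℕ.∸ (c ℕ.+ d) ℕ.∸ 2 ≡ N
  p+2k∸[c+d]∸2≡N = trans (cong (ℕ._∸ 2) (m+n≡o⇒o∸m≡n (c ℕ.+ d) (identity K c₁ d₁ e))) (ℕP.m+n∸n≡m N 2)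
    where
    identity : ∀ K c₁ d₁ e → suc K ℕ.+ c₁ ℕ.+ (suc K ℕ.+ c₁ ℕ.+ d₁) ℕ.+ (e ℕ.+ K ℕ.+ K ℕ.+ 2)
                             ≡ suc K ℕ.+ c₁ ℕ.+ (suc K ℕ.+ c₁ ℕ.+ d₁) ℕ.+ e ℕ.+ 2 ℕ.* suc K
    identity = ℕSolver.solve-∀

  c+1∸k≡1+c₁ : c ℕ.+ 1 ℕ.∸ k ≡ suc c₁
  c+1∸k≡1+c₁ = m+n≡o⇒o∸m≡n k (identity K c₁)
    where
    identity : ∀ K c₁ → suc K ℕ.+ suc c₁ ≡ suc K ℕ.+ c₁ ℕ.+ 1
    identity = ℕSolver.solve-∀

  d+1∸k≡1+n : d ℕ.+ 1 ℕ.∸ k ≡ suc n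
  d+1∸k≡1+n = m+n≡o⇒o∸m≡n k (identity K c₁ d₁)
    where
    identity : ∀ K c₁ d₁ → suc K ℕ.+ suc (c₁ ℕ.+ d₁) ≡ suc K ℕ.+ c₁ ℕ.+ d₁ ℕ.+ 1
    identity = ℕSolver.solve-∀

  c+d+1∸k≡1+m : c ℕ.+ d ℕ.+ 1 ℕ.∸ k ≡ suc m
  c+d+1∸k≡1+m = m+n≡o⇒o∸m≡n k (identity K c₁ d₁)
    where
    identity : ∀ K c₁ d₁ → suc K ℕ.+ suc (K ℕ.+ suc (c₁ ℕ.+ (c₁ ℕ.+ d₁)))
                           ≡ suc K ℕ.+ c₁ ℕ.+ (suc K ℕ.+ c₁ ℕ.+ d₁) ℕ.+ 1
    identity = ℕSolver.solve-∀

  1+m≡c+1+n : suc m ≡ c ℕ.+ suc n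
  1+m≡c+1+n = identity K c₁ d₁
    where
    identity : ∀ K c₁ d₁ → suc (K ℕ.+ suc (c₁ ℕ.+ (c₁ ℕ.+ d₁))) ≡ suc K ℕ.+ c₁ ℕ.+ suc (c₁ ℕ.+ d₁)
    identity = ℕSolver.solve-∀

  c≡1+c₁+K : c ≡ suc c₁ ℕ.+ K
  c≡1+c₁+K = cong suc (ℕP.+-comm K c₁)

  ℓ+[a+ℓ′]≡a+1+m : ∀ ℓ ℓ′ a → ℓ ℕ.+ ℓ′ ≡ suc m → ℓ ℕ.+ (a ℕ.+ ℓ′) ≡ a ℕ.+ suc m
  ℓ+[a+ℓ′]≡a+1+m ℓ ℓ′ a ℓ+ℓ′≡1+m = trans (identity ℓ a ℓ′) (cong (a ℕ.+_) ℓ+ℓ′≡1+m)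
    where
    identity : ∀ ℓ a ℓ′ → ℓ ℕ.+ (a ℕ.+ ℓ′) ≡ a ℕ.+ (ℓ ℕ.+ ℓ′)
    identity = ℕSolver.solve-∀

  C-summand D-summand : ℕ → ℕ → ℤ
  C-summand ℓ j = binomℤ (k ℕ.+ j ℕ.∸ 2) (+ (k ℕ.∸ 1)) * binomℤ (c ℕ.+ d ℕ.∸ k) (+ (d ℕ.+ j ℕ.∸ 1))
                  * binomℤ (p ℕ.+ 2 ℕ.* k ℕ.∸ (c ℕ.+ d) ℕ.∸ 2) ((+ (k ℕ.+ j)) - + 1 - + ℓ)
  D-summand ℓ j = binomℤ (d ℕ.∸ j) (+ (k ℕ.∸ 1)) * binomℤ (c ℕ.+ d ℕ.∸ k) (+ (j ℕ.∸ 1))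
                  * binomℤ (p ℕ.+ 2 ℕ.* k ℕ.∸ (c ℕ.+ d) ℕ.∸ 2) ((+ (p ℕ.+ k ℕ.+ j)) - + d - + 1 - + ℓ)

  C-summand≡ : ∀ ℓ ℓ′ a b → ℓ ℕ.+ ℓ′ ≡ suc m → a ℕ.+ b ≡ c₁ →
               C-summand ℓ (suc a) ≡ + ((K ℕ.+ a) C K) * + (m C b) * binomℤ N (+ (a ℕ.+ ℓ′) - + r)
  C-summand≡ ℓ ℓ′ a b ℓ+ℓ′≡1+m a+b≡c₁ = cong₂ _*_ (cong₂ _*_ first second) third
    where
    first : binomℤ (k ℕ.+ suc a ℕ.∸ 2) (+ (k ℕ.∸ 1)) ≡ + ((K ℕ.+ a) C K)
    first = cong (λ z → + ((z ℕ.∸ 1) C K)) (ℕP.+-suc K a)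

    second : binomℤ (c ℕ.+ d ℕ.∸ k) (+ (d ℕ.+ suc a ℕ.∸ 1)) ≡ + (m C b)
    second = cong +_ (trans (cong₂ _C_ c+d∸k≡m (cong (ℕ._∸ 1) (ℕP.+-suc d a))) (C-sym (d ℕ.+ a) b d+a+b≡m))
      where
      identity : ∀ K c₁ d₁ → suc K ℕ.+ c₁ ℕ.+ d₁ ℕ.+ c₁ ≡ K ℕ.+ suc (c₁ ℕ.+ (c₁ ℕ.+ d₁))
      identity = ℕSolver.solve-∀
      d+a+b≡m : d ℕ.+ a ℕ.+ b ≡ m
      d+a+b≡m = trans (ℕP.+-assoc d a b) (trans (cong (d ℕ.+_) a+b≡c₁) (identity K c₁ d₁))

    third : binomℤ (p ℕ.+ 2 ℕ.* k ℕ.∸ (c ℕ.+ d) ℕ.∸ 2) ((+ (k ℕ.+ suc a)) - + 1 - + ℓ)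
            ≡ binomℤ N (+ (a ℕ.+ ℓ′) - + r)
    third = cong₂ binomℤ p+2k∸[c+d]∸2≡N (+a-+b≡+c-+d (K ℕ.+ suc a) ℓ (a ℕ.+ ℓ′) r K+1+a+r≡[a+ℓ′]+ℓ)
      where
      identity : ∀ K a r → K ℕ.+ suc a ℕ.+ r ≡ a ℕ.+ suc (K ℕ.+ r)
      identity = ℕSolver.solve-∀
      K+1+a+r≡[a+ℓ′]+ℓ : K ℕ.+ suc a ℕ.+ r ≡ a ℕ.+ ℓ′ ℕ.+ ℓ
      K+1+a+r≡[a+ℓ′]+ℓ = trans (identity K a r)
                                (trans (sym (ℓ+[a+ℓ′]≡a+1+m ℓ ℓ′ a ℓ+ℓ′≡1+m)) (ℕP.+-comm ℓ (a ℕ.+ ℓ′)))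

  D-summand≡ : ∀ ℓ a b → a ℕ.+ b ≡ n →
               D-summand ℓ (suc a) ≡ + ((K ℕ.+ b) C K) * + (m C (c ℕ.+ b)) * binomℤ N (+ p - + (ℓ ℕ.+ b))
  D-summand≡ ℓ a b a+b≡n = cong₂ _*_ (cong₂ _*_ first second) third
    where
    d≡k+[a+b] : d ≡ k ℕ.+ (a ℕ.+ b)
    d≡k+[a+b] = trans (ℕP.+-assoc k c₁ d₁) (cong (k ℕ.+_) (sym a+b≡n))

    first : binomℤ (d ℕ.∸ suc a) (+ (k ℕ.∸ 1)) ≡ + ((K ℕ.+ b) C K)
    first = cong (λ z → + (z C K)) (m+n≡o⇒o∸m≡n (suc a) (trans (identity K a b) (sym d≡k+[a+b])))
      where
      identity : ∀ K a b → suc a ℕ.+ (K ℕ.+ b) ≡ suc K ℕ.+ (a ℕ.+ b)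
      identity = ℕSolver.solve-∀

    second : binomℤ (c ℕ.+ d ℕ.∸ k) (+ (suc a ℕ.∸ 1)) ≡ + (m C (c ℕ.+ b))
    second = cong +_ (trans (cong (_C a) c+d∸k≡m) (C-sym a (c ℕ.+ b) a+[c+b]≡m))
      where
      identity : ∀ a K c₁ b → a ℕ.+ (suc K ℕ.+ c₁ ℕ.+ b) ≡ K ℕ.+ suc (c₁ ℕ.+ (a ℕ.+ b))
      identity = ℕSolver.solve-∀
      a+[c+b]≡m : a ℕ.+ (c ℕ.+ b) ≡ m
      a+[c+b]≡m = trans (identity a K c₁ b) (cong (λ z → K ℕ.+ suc (c₁ ℕ.+ z)) a+b≡n)

    third : binomℤ (p ℕ.+ 2 ℕ.* k ℕ.∸ (c ℕ.+ d) ℕ.∸ 2) ((+ (p ℕ.+ k ℕ.+ suc a)) - + d - + 1 - + ℓ)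
            ≡ binomℤ N (+ p - + (ℓ ℕ.+ b))
    third = cong₂ binomℤ p+2k∸[c+d]∸2≡N
                  (trans (cong₂ (λ u w → u - w - + 1 - + ℓ) p+k+1+a≡ d≡) (identity (+ p) (+ k) (+ a) (+ b) (+ ℓ)))
      where
      p+k+1+a≡ : + (p ℕ.+ k ℕ.+ suc a) ≡ + p + + k + (+ 1 + + a)
      p+k+1+a≡ = trans (ℤP.pos-+ (p ℕ.+ k) (suc a)) (cong (_+ + suc a) (ℤP.pos-+ p k))
      d≡ : + d ≡ + k + (+ a + + b)
      d≡ = trans (cong +_ d≡k+[a+b]) (trans (ℤP.pos-+ k (a ℕ.+ b)) (cong (_+_ (+ k)) (ℤP.pos-+ a b)))
      identity : ∀ p k a b ℓ → p + k + (+ 1 + a) - (k + (a + b)) - + 1 - ℓ ≡ p - (ℓ + b)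
      identity = solve-∀

  g : ℕ → ℤ → ℤ
  g ℓ y = binom (y - + 1) K * binom (y + (+ r - + ℓ)) r

  term : ℕ → ℕ → ℤ
  term ℓ v = sgn (ℓ ℕ.+ c) * (sgn v * + (m C v) * g ℓ (+ c - + v))

  ∑term≡±mCK : ∀ ℓ → ∑ (suc m) (term ℓ) ≡ sgn (ℓ ℕ.+ c) * + (m C K)
  ∑term≡±mCK ℓ = begin
    ∑ (suc m) (term ℓ)
      ≡⟨ ∑-*ˡ (suc m) (sgn (ℓ ℕ.+ c)) _ ⟩
    sgn (ℓ ℕ.+ c) * ∑ (suc m) (λ v → sgn v * + (m C v) * g ℓ (+ c - + v))
      ≡⟨ cong (sgn (ℓ ℕ.+ c) *_) (sym (∇^-expand m (g ℓ) (+ c))) ⟩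
    sgn (ℓ ℕ.+ c) * ∇^ m (g ℓ) (+ c)
      ≡⟨ cong (sgn (ℓ ℕ.+ c) *_) (∇^-binom*binom m K r (- + 1) (+ r - + ℓ) (+ c) refl) ⟩
    sgn (ℓ ℕ.+ c) * + (m C K)
      ∎
    where open ≡-Reasoning

  term-vanishes : ∀ ℓ i → i ℕ.< K → term ℓ (suc c₁ ℕ.+ i) ≡ + 0
  term-vanishes ℓ i i<K with ℕP.m≤n⇒∃[o]m+o≡n i<K
  ... | w , 1+i+w≡K = begin
    term ℓ v                       ≡⟨ cong (λ z → s * (a * (binom z K * G))) c-v-1≡w ⟩
    s * (a * (+ (w C K) * G))      ≡⟨ cong (λ z → s * (a * (+ z * G))) (k>n⇒nCk≡0 w<K) ⟩
    s * (a * (+ 0 * G))            ≡⟨ annihilate s a G ⟩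
    + 0                            ∎
    where
    open ≡-Reasoning
    v : ℕ
    v = suc c₁ ℕ.+ i
    s a G : ℤ
    s = sgn (ℓ ℕ.+ c)
    a = sgn v * + (m C v)
    G = binom (+ c - + v + (+ r - + ℓ)) r
    w<K : w ℕ.< K
    w<K = subst (w ℕ.<_) 1+i+w≡K (ℕP.m<n+m w (s≤s z≤n))
    c-v-1≡w : + c - + v - + 1 ≡ + w
    c-v-1≡w = cong (_- + 1) (+m-+n≡+o v (suc w) (trans (identity c₁ i w) (cong (λ z → suc z ℕ.+ c₁) 1+i+w≡K)))
      where
      identity : ∀ c₁ i w → suc c₁ ℕ.+ i ℕ.+ suc w ≡ suc (suc i ℕ.+ w) ℕ.+ c₁
      identity = ℕSolver.solve-∀
    annihilate : ∀ s a x → s * (a * (+ 0 * x)) ≡ + 0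
    annihilate = solve-∀

  ∑[c]term≡∑[1+c₁]term : ∀ ℓ → ∑ c (term ℓ) ≡ ∑ (suc c₁) (term ℓ)
  ∑[c]term≡∑[1+c₁]term ℓ = begin
    ∑ c (term ℓ)
      ≡⟨ cong (λ t → ∑ t (term ℓ)) c≡1+c₁+K ⟩
    ∑ (suc c₁ ℕ.+ K) (term ℓ)
      ≡⟨ ∑-split (suc c₁) K (term ℓ) ⟩
    ∑ (suc c₁) (term ℓ) + ∑ K (λ i → term ℓ (suc c₁ ℕ.+ i))
      ≡⟨ cong (_+_ (∑ (suc c₁) (term ℓ))) (∑-zero K _ (term-vanishes ℓ)) ⟩
    ∑ (suc c₁) (term ℓ) + + 0
      ≡⟨ ℤP.+-identityʳ _ ⟩
    ∑ (suc c₁) (term ℓ)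
      ∎
    where open ≡-Reasoning

  module _ (p-prime : Prime p) where
    open Congruence p

    C-summand≈term : ∀ ℓ ℓ′ → 1 ℕ.≤ ℓ → ℓ ℕ.+ ℓ′ ≡ suc m → ∀ a b → suc (a ℕ.+ b) ≡ suc c₁ →
                     C-summand ℓ (suc a) ≈ term ℓ b
    C-summand≈term ℓ ℓ′ 1≤ℓ ℓ+ℓ′≡1+m a b 1+a+b≡1+c₁ = begin
      C-summand ℓ (suc a)
        ≡⟨ C-summand≡ ℓ ℓ′ a b ℓ+ℓ′≡1+m a+b≡c₁ ⟩
      A * M * binomℤ N (+ t - + r)
        ≈⟨ *-congˡ (A * M) (binomℤ[N,t-r]≈ p-prime N+1+r≡p t t<p+r) ⟩
      A * M * (sgn (t ℕ.+ r) * + (t C r))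
        ≡⟨ cong (λ s → A * M * (s * + (t C r))) sign ⟩
      A * M * (sgn (ℓ ℕ.+ c) * sgn b * + (t C r))
        ≡⟨ rearrange A M (sgn (ℓ ℕ.+ c)) (sgn b) (+ (t C r)) ⟩
      sgn (ℓ ℕ.+ c) * (sgn b * M * (A * + (t C r)))
        ≡⟨ cong₂ (λ u w → sgn (ℓ ℕ.+ c) * (sgn b * M * (binom u K * binom w r))) (sym c-b-1≡K+a) (sym c-b+r-ℓ≡t) ⟩
      term ℓ b
        ∎
      where
      open ≈-Reasoning
      t : ℕ
      t = a ℕ.+ ℓ′
      A M : ℤ
      A = + ((K ℕ.+ a) C K)
      M = + (m C b)

      a+b≡c₁ : a ℕ.+ b ≡ c₁
      a+b≡c₁ = ℕP.suc-injective 1+a+b≡1+c₁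

      b+1+K+a≡c : b ℕ.+ suc (K ℕ.+ a) ≡ c
      b+1+K+a≡c = trans (identity K a b) (cong (suc K ℕ.+_) a+b≡c₁)
        where
        identity : ∀ K a b → b ℕ.+ suc (K ℕ.+ a) ≡ suc K ℕ.+ (a ℕ.+ b)
        identity = ℕSolver.solve-∀

      t<p+r : t ℕ.< p ℕ.+ r
      t<p+r = subst (t ℕ.<_) (ℕP.+-comm r p) (ℕP.+-mono-≤-< a≤r ℓ′<p)
        where
        a≤r : a ℕ.≤ r
        a≤r = ℕP.≤-trans (subst (a ℕ.≤_) a+b≡c₁ (ℕP.m≤m+n a b)) (ℕP.≤-trans (ℕP.m≤m+n c₁ n) (ℕP.n≤1+n _))
        ℓ′<p : ℓ′ ℕ.< p
        ℓ′<p = ℕP.≤-<-trans (ℕP.≤-pred (subst (suc ℓ′ ℕ.≤_) ℓ+ℓ′≡1+m (ℕP.+-monoˡ-≤ ℓ′ 1≤ℓ))) m<p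

      sign : sgn (t ℕ.+ r) ≡ sgn (ℓ ℕ.+ c) * sgn b
      sign = trans (sgn-parity (t ℕ.+ r) (ℓ ℕ.+ c ℕ.+ b) (ℓ ℕ.+ b) r parity) (sgn-+ (ℓ ℕ.+ c) b)
        where
        identity₁ : ∀ a ℓ ℓ′ r b → a ℕ.+ ℓ′ ℕ.+ r ℕ.+ (ℓ ℕ.+ b ℕ.+ (ℓ ℕ.+ b)) ≡ ℓ ℕ.+ b ℕ.+ b ℕ.+ r ℕ.+ (ℓ ℕ.+ (a ℕ.+ ℓ′))
        identity₁ = ℕSolver.solve-∀
        identity₂ : ∀ ℓ b r a K → ℓ ℕ.+ b ℕ.+ b ℕ.+ r ℕ.+ (a ℕ.+ suc (K ℕ.+ r))
                                  ≡ ℓ ℕ.+ (suc K ℕ.+ (a ℕ.+ b)) ℕ.+ b ℕ.+ (r ℕ.+ r)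
        identity₂ = ℕSolver.solve-∀
        parity : t ℕ.+ r ℕ.+ (ℓ ℕ.+ b ℕ.+ (ℓ ℕ.+ b)) ≡ ℓ ℕ.+ c ℕ.+ b ℕ.+ (r ℕ.+ r)
        parity = trans (identity₁ a ℓ ℓ′ r b)
                 (trans (cong (ℓ ℕ.+ b ℕ.+ b ℕ.+ r ℕ.+_) (ℓ+[a+ℓ′]≡a+1+m ℓ ℓ′ a ℓ+ℓ′≡1+m))
                 (trans (identity₂ ℓ b r a K) (cong (λ z → ℓ ℕ.+ (suc K ℕ.+ z) ℕ.+ b ℕ.+ (r ℕ.+ r)) a+b≡c₁)))

      c-b≡1+K+a : + c - + b ≡ + suc (K ℕ.+ a)
      c-b≡1+K+a = +m-+n≡+o b (suc (K ℕ.+ a)) b+1+K+a≡c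

      c-b-1≡K+a : + c - + b - + 1 ≡ + (K ℕ.+ a)
      c-b-1≡K+a = cong (_- + 1) c-b≡1+K+a

      c-b+r-ℓ≡t : + c - + b + (+ r - + ℓ) ≡ + t
      c-b+r-ℓ≡t =
        trans (cong (_+ (+ r - + ℓ)) c-b≡1+K+a)
              (trans (sym (ℤP.+-assoc (+ suc (K ℕ.+ a)) (+ r) (- + ℓ)))
                     (+m-+n≡+o ℓ t (trans (ℓ+[a+ℓ′]≡a+1+m ℓ ℓ′ a ℓ+ℓ′≡1+m) (identity a K r))))
        where
        identity : ∀ a K r → a ℕ.+ suc (K ℕ.+ r) ≡ suc (K ℕ.+ a) ℕ.+ r
        identity = ℕSolver.solve-∀

      rearrange : ∀ A M s s′ T → A * M * (s * s′ * T) ≡ s * (s′ * M * (A * T))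
      rearrange = solve-∀

    D-summand≈term : ∀ ℓ → 1 ℕ.≤ ℓ → ℓ ℕ.≤ suc m → ∀ a b → suc (a ℕ.+ b) ≡ suc n →
                     sgn k * D-summand ℓ (suc a) ≈ term ℓ (c ℕ.+ b)
    D-summand≈term ℓ 1≤ℓ ℓ≤1+m a b 1+a+b≡1+n = begin
      sgn k * D-summand ℓ (suc a)
        ≡⟨ cong (sgn k *_) (D-summand≡ ℓ a b (ℕP.suc-injective 1+a+b≡1+n)) ⟩
      sgn k * (B * M * binomℤ N (+ p - + y))
        ≈⟨ *-congˡ (sgn k) (*-congˡ (B * M) (binomℤ[N,p-y]≈ p-prime N+1+r≡p y 1≤y y≤p+r)) ⟩
      sgn k * (B * M * (- sgn y * G))
        ≡⟨ cong (λ s → sgn k * (B * M * (- s * G))) sign ⟩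
      sgn k * (B * M * (- (sgn (ℓ ℕ.+ c) * sgn v) * G))
        ≡⟨ rearrange (sgn K) B M (sgn (ℓ ℕ.+ c)) (sgn v) G ⟩
      sgn (ℓ ℕ.+ c) * (sgn v * M * (sgn K * B * G))
        ≡⟨ cong₂ (λ u w → sgn (ℓ ℕ.+ c) * (sgn v * M * (u * w))) lower upper ⟩
      term ℓ v
        ∎
      where
      open ≈-Reasoning
      v y : ℕ
      v = c ℕ.+ b
      y = ℓ ℕ.+ b
      B M G : ℤ
      B = + ((K ℕ.+ b) C K)
      M = + (m C v)
      G = binom (+ r - + y) r

      1≤y : 1 ℕ.≤ y
      1≤y = ℕP.≤-trans 1≤ℓ (ℕP.m≤m+n ℓ b)

      y≤p+r : y ℕ.≤ p ℕ.+ r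
      y≤p+r = ℕP.+-mono-≤ (ℕP.≤-trans ℓ≤1+m m<p) b≤r
        where
        b≤r : b ℕ.≤ r
        b≤r = ℕP.≤-trans (subst (b ℕ.≤_) (ℕP.suc-injective 1+a+b≡1+n) (ℕP.m≤n+m b a))
                         (ℕP.≤-trans (ℕP.m≤n+m n c₁) (ℕP.n≤1+n _))

      sign : sgn y ≡ sgn (ℓ ℕ.+ c) * sgn v
      sign = trans (sgn-parity y (ℓ ℕ.+ c ℕ.+ v) c 0 (identity ℓ b c)) (sgn-+ (ℓ ℕ.+ c) v)
        where
        identity : ∀ ℓ b c → ℓ ℕ.+ b ℕ.+ (c ℕ.+ c) ≡ ℓ ℕ.+ c ℕ.+ (c ℕ.+ b) ℕ.+ 0
        identity = ℕSolver.solve-∀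

      c-v≡-b : + c - + v ≡ - + b
      c-v≡-b = trans (cong (λ z → + c - z) (ℤP.pos-+ c b)) (identity (+ c) (+ b))
        where
        identity : ∀ c b → c - (c + b) ≡ - b
        identity = solve-∀

      lower : sgn K * B ≡ binom (+ c - + v - + 1) K
      lower = trans (cong (λ z → sgn K * + (z C K)) (ℕP.+-comm K b))
                    (cong (λ z → binom z K) (sym (trans (cong (_- + 1) c-v≡-b) (identity (+ b)))))
        where
        identity : ∀ b → - b - + 1 ≡ - (+ 1 + b)
        identity = solve-∀

      upper : G ≡ binom (+ c - + v + (+ r - + ℓ)) r
      upper = cong (λ z → binom z r) (sym (trans (cong (_+ (+ r - + ℓ)) c-v≡-b) (identity (+ b) (+ r) (+ ℓ))))
        where
        identity : ∀ b r ℓ → - b + (r - ℓ) ≡ r - (ℓ + b)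
        identity = solve-∀

      rearrange : ∀ sK B M s s′ G → - sK * (B * M * (- (s * s′) * G)) ≡ s * (s′ * M * (sK * B * G))
      rearrange = solve-∀

    ff≈±mCK : ∀ ℓ → 1 ℕ.≤ ℓ → ℓ ℕ.≤ c ℕ.+ d ℕ.+ 1 ℕ.∸ k → ff p k c d ℓ ≈ sgn (ℓ ℕ.+ c) * + (m C K)
    ff≈±mCK ℓ 1≤ℓ ℓ≤c+d+1-k with ℕP.m≤n⇒∃[o]m+o≡n (subst (ℓ ℕ.≤_) c+d+1∸k≡1+m ℓ≤c+d+1-k)
    ... | ℓ′ , ℓ+ℓ′≡1+m = begin
      Cf p k c d ℓ + sgn k * Df p k c d ℓ
        ≈⟨ +-cong C-part D-part ⟩
      ∑ (suc c₁) (term ℓ) + ∑ (suc n) (λ b → term ℓ (c ℕ.+ b))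
        ≡⟨ cong (_+ ∑ (suc n) (λ b → term ℓ (c ℕ.+ b))) (sym (∑[c]term≡∑[1+c₁]term ℓ)) ⟩
      ∑ c (term ℓ) + ∑ (suc n) (λ b → term ℓ (c ℕ.+ b))
        ≡⟨ sym (∑-split c (suc n) (term ℓ)) ⟩
      ∑ (c ℕ.+ suc n) (term ℓ)
        ≡⟨ cong (λ t → ∑ t (term ℓ)) (sym 1+m≡c+1+n) ⟩
      ∑ (suc m) (term ℓ)
        ≡⟨ ∑term≡±mCK ℓ ⟩
      sgn (ℓ ℕ.+ c) * + (m C K)
        ∎
      where
      open ≈-Reasoning
      ℓ≤1+m : ℓ ℕ.≤ suc m
      ℓ≤1+m = subst (ℓ ℕ.≤_) c+d+1∸k≡1+m ℓ≤c+d+1-k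

      C-part : Cf p k c d ℓ ≈ ∑ (suc c₁) (term ℓ)
      C-part = begin
        Cf p k c d ℓ
          ≡⟨ sumFrom1≡∑ (c ℕ.+ 1 ℕ.∸ k) (C-summand ℓ) ⟩
        ∑ (c ℕ.+ 1 ℕ.∸ k) (λ a → C-summand ℓ (suc a))
          ≡⟨ cong (λ t → ∑ t (λ a → C-summand ℓ (suc a))) c+1∸k≡1+c₁ ⟩
        ∑ (suc c₁) (λ a → C-summand ℓ (suc a))
          ≈⟨ ∑-reverse (suc c₁) _ _ (C-summand≈term ℓ ℓ′ 1≤ℓ ℓ+ℓ′≡1+m) ⟩
        ∑ (suc c₁) (term ℓ)
          ∎

      D-part : sgn k * Df p k c d ℓ ≈ ∑ (suc n) (λ b → term ℓ (c ℕ.+ b))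
      D-part = begin
        sgn k * Df p k c d ℓ
          ≡⟨ cong (sgn k *_) (sumFrom1≡∑ (d ℕ.+ 1 ℕ.∸ k) (D-summand ℓ)) ⟩
        sgn k * ∑ (d ℕ.+ 1 ℕ.∸ k) (λ a → D-summand ℓ (suc a))
          ≡⟨ cong (λ t → sgn k * ∑ t (λ a → D-summand ℓ (suc a))) d+1∸k≡1+n ⟩
        sgn k * ∑ (suc n) (λ a → D-summand ℓ (suc a))
          ≡⟨ sym (∑-*ˡ (suc n) (sgn k) _) ⟩
        ∑ (suc n) (λ a → sgn k * D-summand ℓ (suc a))
          ≈⟨ ∑-reverse (suc n) _ _ (D-summand≈term ℓ 1≤ℓ ℓ≤1+m) ⟩
        ∑ (suc n) (λ b → term ℓ (c ℕ.+ b))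
          ∎

theorem1 : (p k c d : ℕ) → Prime p → 1 ℕ.≤ k → k ℕ.≤ c → c ℕ.≤ d → d ℕ.< c ℕ.+ d → c ℕ.+ d ℕ.≤ p →
    (¬ (ff p k c d 1 ≡[mod p ] (+ 0)))
    × (∀ (ℓ : ℕ) → 1 ℕ.≤ ℓ → ℓ ℕ.≤ c ℕ.+ d ℕ.+ 1 ℕ.∸ k →
         ff p k c d ℓ ≡[mod p ] (sgn (ℓ ℕ.∸ 1) * ff p k c d 1))
theorem1 p (suc K) c d p-prime (s≤s z≤n) k≤c c≤d _ c+d≤p
  with ℕP.m≤n⇒∃[o]m+o≡n k≤c | ℕP.m≤n⇒∃[o]m+o≡n c≤d | ℕP.m≤n⇒∃[o]m+o≡n c+d≤p
... | c₁ , refl | d₁ , refl | e , refl = nonzero , alternating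
  where
  open Reduction K c₁ d₁ e using (m; r; m<p; c+d+1∸k≡1+m; ff≈±mCK)
  open Congruence p

  ff[1]≈ : ff p (suc K) c d 1 ≈ sgn (1 ℕ.+ c) * + (m C K)
  ff[1]≈ = ff≈±mCK p-prime 1 (s≤s z≤n) (subst (1 ℕ.≤_) (sym c+d+1∸k≡1+m) (s≤s z≤n))

  nonzero : ¬ (ff p (suc K) c d 1 ≡[mod p ] (+ 0))
  nonzero p∣ff[1] = sgn*nCk≉0 p-prime (1 ℕ.+ c) (ℕP.m≤m+n K r) m<p (≈-trans (≈-sym ff[1]≈) (mk≈ (ℤ∣.∣ᵤ⇒∣ p∣ff[1])))

  alternating : ∀ ℓ → 1 ℕ.≤ ℓ → ℓ ℕ.≤ c ℕ.+ d ℕ.+ 1 ℕ.∸ suc K →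
                ff p (suc K) c d ℓ ≡[mod p ] (sgn (ℓ ℕ.∸ 1) * ff p (suc K) c d 1)
  alternating (suc ℓ) 1≤1+ℓ 1+ℓ≤c+d+1-k = ℤ∣.∣⇒∣ᵤ (p∣a-b (begin
    ff p (suc K) c d (suc ℓ)               ≈⟨ ff≈±mCK p-prime (suc ℓ) 1≤1+ℓ 1+ℓ≤c+d+1-k ⟩
    sgn (suc ℓ ℕ.+ c) * + (m C K)          ≡⟨ cong (λ s → - s * + (m C K)) (sgn-+ ℓ c) ⟩
    - (sgn ℓ * sgn c) * + (m C K)          ≡⟨ regroup (sgn ℓ) (sgn c) (+ (m C K)) ⟩
    sgn ℓ * (sgn (1 ℕ.+ c) * + (m C K))    ≈⟨ *-congˡ (sgn ℓ) (≈-sym ff[1]≈) ⟩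
    sgn ℓ * ff p (suc K) c d 1             ∎))
    where
    open ≈-Reasoning
    regroup : ∀ a b x → - (a * b) * x ≡ a * (- b * x)
    regroup = solve-∀
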